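{- For every positive integer $n$, $|P_{n,2}|=\frac{n+3}{2}\binom{2n}{n-3}$.
   Context: Place $2n$ points on a circle, labeled $1,\dots,2n$ clockwise. A matching is a perfect matching of these points drawn as chords; two chords cross if their endpoints interleave in circular order. $P_{n,k}$ denotes the set of matchings with exactly $k$ crossing pairs of chords. The binomial coefficient $\binom{a}{b}$ is $0$ if $b<0$. -}

module Defs where

open import Data.Nat using (ℕ; zero; suc; _+_; _*_; _≡ᵇ_)
open import Data.Nat.Combinatorics using (_C_)
open import Data.Integer using (ℤ; +_; -[1+_])
open import Data.Bool using (Bool; true; false; _∧_; if_then_else_)
open import Data.Fin using (Fin; _<?_)
open import Data.Fin.Properties using (_≟_)
open import Data.List using (List; []; _∷_; map; concatMap; filter; length; allFin)
open import Data.Bool.ListAction using (and)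
open import Data.Vec using (Vec; lookup)
import Data.Vec as V
open import Relation.Nullary.Decidable using (⌊_⌋; ¬?)

-- All vectors of length m with entries in Fin k (i.e. all functions Fin m → Fin k,
-- tabulated so that equality is decidable and extensional).
allVecs : (k m : ℕ) → List (Vec (Fin k) m)
allVecs k zero    = V.[] ∷ []
allVecs k (suc m) = concatMap (λ x → map (x V.∷_) (allVecs k m)) (allFin k)

-- A perfect matching on the points 0,…,m-1 (points 1..2n of the paper, shifted)
-- is encoded by its partner function v : i ↦ partner of i, i.e. a fixed-point-free
-- involution.
isMatching : {m : ℕ} → Vec (Fin m) m → Bool
isMatching {m} v =
  and (map (λ i → ⌊ lookup v (lookup v i) ≟ i ⌋ ∧ ⌊ ¬? (lookup v i ≟ i) ⌋) (allFin m))

-- Chords {a, v a} and {b, v b}, with a < v a, b < v b and a < b, cross iff their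
-- endpoints interleave: a < b < v a < v b.
-- Hence each unordered crossing pair of chords is counted exactly once below.
crossingPair : {m : ℕ} → Vec (Fin m) m → Fin m → Fin m → Bool
crossingPair v a b =
  ⌊ a <? b ⌋ ∧ ⌊ b <? lookup v a ⌋ ∧ ⌊ lookup v a <? lookup v b ⌋

crossings : {m : ℕ} → Vec (Fin m) m → ℕ
crossings {m} v =
  length (filter (λ p → crossingPair v (Data.Product.proj₁ p) (Data.Product.proj₂ p) Data.Bool.≟ true)
                 (concatMap (λ a → map (λ b → a Data.Product., b) (allFin m)) (allFin m)))
  where import Data.Product
        import Data.Bool

P : (n k : ℕ) → List (Vec (Fin (2 * n)) (2 * n))
P n k = filter (λ v → (isMatching v ∧ (crossings v ≡ᵇ k)) Data.Bool.≟ true) (allVecs (2 * n) (2 * n))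
  where import Data.Bool

binom : ℕ → ℤ → ℕ
binom a (+ b)      = a C b
binom a -[1+ _ ]   = 0

module Submission where

-- Generalise from perfect matchings to partial matchings of t points in a row: involutions whose fixed
-- points are "open".  Thinking of an open point as a half-chord running off to the right, the weight of
-- a partial matching counts its crossing pairs of chords together with the pairs (chord, open point)
-- where the chord passes over the open point; without open points it is the number of crossings.
-- Deleting the leftmost point, remembering its partner, is a bijection: if it was open, the rest has one
-- open point fewer and the same weight; if it was matched, its partner p becomes open and the weight
-- drops by the number of open points left of p.  Hence the number of partial matchings with h open
-- points and weight w obeys a recurrence in t, solved for w = 0, 1, 2 by closed binomial formulas in
-- t = 2j + h, checked by induction on j with Pascal's rule and (k + 1) C(N, k + 1) = (N - k) C(N, k).
-- For h = 0 and w = 2 this is the theorem.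

open import Data.Bool using (Bool; true; false; _∧_; if_then_else_)
open import Data.Fin using (Fin; zero; suc; _<?_)
open import Data.Fin.Properties using (_≟_)
open import Data.List using (List; []; _∷_)
open import Data.Nat using (ℕ; zero; suc)
open import Data.Vec using (Vec; lookup)
open import Function using (_∘_)
open import Relation.Binary.PropositionalEquality
open import Relation.Nullary.Decidable using (Dec; does; yes; no)

open import Defs
open ≡-Reasoning

module Counting where

  open import Data.Bool.ListAction using (and)
  open import Data.Bool.Properties using (if-eta)
  import Data.Bool as Bool
  open import Data.Fin.Properties using (all?)
  open import Data.List using (_++_; map; concatMap; filter; length; tabulate; allFin)
  open import Data.Nat using (_+_; _∸_; _<ᵇ_; _≡ᵇ_; pred)
  open import Data.Nat.Properties
    using (+-assoc; +-identityʳ; +-commutativeSemigroup; m+n≡0⇒m≡0; m+n≡0⇒n≡0)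
  open import Algebra.Properties.CommutativeSemigroup +-commutativeSemigroup using (interchange)
  open import Data.Vec using ([]; _∷_)
  open import Data.Vec.Properties using (≡-dec)
  open import Level using (0ℓ)
  open import Relation.Binary.Definitions using (DecidableEquality)
  open import Relation.Nullary using (contradiction)
  open import Relation.Unary using (Pred; Decidable)

  private variable
    A B : Set
    n t : ℕ

  𝟙 : Bool → ℕ
  𝟙 b = if b then 1 else 0

  𝟙≡0⇒false : ∀ {b} → 𝟙 b ≡ 0 → b ≡ false
  𝟙≡0⇒false {false} _ = refl

  ∑ˡ : List A → (A → ℕ) → ℕ
  ∑ˡ []       f = 0
  ∑ˡ (x ∷ xs) f = f x + ∑ˡ xs f

  ∑ˡ-cong : (xs : List A) {f g : A → ℕ} → (∀ x → f x ≡ g x) → ∑ˡ xs f ≡ ∑ˡ xs g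
  ∑ˡ-cong []       f≗g = refl
  ∑ˡ-cong (x ∷ xs) f≗g = cong₂ _+_ (f≗g x) (∑ˡ-cong xs f≗g)

  ∑ˡ-zero : (xs : List A) → ∑ˡ xs (λ _ → 0) ≡ 0
  ∑ˡ-zero []       = refl
  ∑ˡ-zero (x ∷ xs) = ∑ˡ-zero xs

  ∑ˡ-distrib-+ : (xs : List A) (f g : A → ℕ) →
                 ∑ˡ xs (λ x → f x + g x) ≡ ∑ˡ xs f + ∑ˡ xs g
  ∑ˡ-distrib-+ []       f g = refl
  ∑ˡ-distrib-+ (x ∷ xs) f g = trans (cong (f x + g x +_) (∑ˡ-distrib-+ xs f g))
                                   (interchange (f x) (g x) (∑ˡ xs f) (∑ˡ xs g))

  ∑ˡ-comm : (xs : List A) (ys : List B) (f : A → B → ℕ) →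
            ∑ˡ xs (λ a → ∑ˡ ys (f a)) ≡ ∑ˡ ys (λ b → ∑ˡ xs (λ a → f a b))
  ∑ˡ-comm []       ys f = sym (∑ˡ-zero ys)
  ∑ˡ-comm (x ∷ xs) ys f =
    trans (cong (∑ˡ ys (f x) +_) (∑ˡ-comm xs ys f)) (sym (∑ˡ-distrib-+ ys (f x) _))

  ∑ˡ-++ : (xs ys : List A) (f : A → ℕ) → ∑ˡ (xs ++ ys) f ≡ ∑ˡ xs f + ∑ˡ ys f
  ∑ˡ-++ []       ys f = refl
  ∑ˡ-++ (x ∷ xs) ys f = trans (cong (f x +_) (∑ˡ-++ xs ys f)) (sym (+-assoc (f x) _ _))

  ∑ˡ-map : (g : A → B) (xs : List A) (f : B → ℕ) → ∑ˡ (map g xs) f ≡ ∑ˡ xs (f ∘ g)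
  ∑ˡ-map g []       f = refl
  ∑ˡ-map g (x ∷ xs) f = cong (f (g x) +_) (∑ˡ-map g xs f)

  ∑ˡ-concatMap : (g : A → List B) (xs : List A) (f : B → ℕ) →
                 ∑ˡ (concatMap g xs) f ≡ ∑ˡ xs (λ x → ∑ˡ (g x) f)
  ∑ˡ-concatMap g []       f = refl
  ∑ˡ-concatMap g (x ∷ xs) f =
    trans (∑ˡ-++ (g x) (concatMap g xs) f) (cong (∑ˡ (g x) f +_) (∑ˡ-concatMap g xs f))

  countᵇ : (A → Bool) → List A → ℕ
  countᵇ p xs = ∑ˡ xs (λ x → 𝟙 (p x))

  length-filter≡countᵇ : (p : A → Bool) (xs : List A) →
                         length (filter (λ x → p x Bool.≟ true) xs) ≡ countᵇ p xs
  length-filter≡countᵇ p []       = refl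
  length-filter≡countᵇ p (x ∷ xs) with p x
  ... | true  = cong suc (length-filter≡countᵇ p xs)
  ... | false = length-filter≡countᵇ p xs

  ∑ : (n : ℕ) → (Fin n → ℕ) → ℕ
  ∑ zero    f = 0
  ∑ (suc n) f = f zero + ∑ n (f ∘ suc)

  ∑-cong : (n : ℕ) {f g : Fin n → ℕ} → (∀ i → f i ≡ g i) → ∑ n f ≡ ∑ n g
  ∑-cong zero    f≗g = refl
  ∑-cong (suc n) f≗g = cong₂ _+_ (f≗g zero) (∑-cong n (f≗g ∘ suc))

  ∑-zero : (n : ℕ) → ∑ n (λ _ → 0) ≡ 0
  ∑-zero zero    = refl
  ∑-zero (suc n) = ∑-zero n

  ∑-zero⁻ : (n : ℕ) (f : Fin n → ℕ) → ∑ n f ≡ 0 → ∀ i → f i ≡ 0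
  ∑-zero⁻ (suc n) f ∑≡0 zero    = m+n≡0⇒m≡0 (f zero) ∑≡0
  ∑-zero⁻ (suc n) f ∑≡0 (suc i) = ∑-zero⁻ n (f ∘ suc) (m+n≡0⇒n≡0 (f zero) ∑≡0) i

  ∑-distrib-+ : (n : ℕ) (f g : Fin n → ℕ) → ∑ n (λ i → f i + g i) ≡ ∑ n f + ∑ n g
  ∑-distrib-+ zero    f g = refl
  ∑-distrib-+ (suc n) f g = trans (cong (f zero + g zero +_) (∑-distrib-+ n (f ∘ suc) (g ∘ suc)))
                                  (interchange (f zero) (g zero) _ _)

  ∑-δ : (n : ℕ) (p : Fin n) (x : ℕ) → ∑ n (λ i → if does (i ≟ p) then x else 0) ≡ x
  ∑-δ (suc n) zero    x = trans (cong (x +_) (∑-zero n)) (+-identityʳ x)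
  ∑-δ (suc n) (suc p) x = ∑-δ n p x

  ∑ˡ-tabulate : (g : Fin n → A) (f : A → ℕ) → ∑ˡ (tabulate g) f ≡ ∑ n (f ∘ g)
  ∑ˡ-tabulate {n = zero}  g f = refl
  ∑ˡ-tabulate {n = suc n} g f = cong (f (g zero) +_) (∑ˡ-tabulate (g ∘ suc) f)

  ∑ˡ-allFin : (n : ℕ) (f : Fin n → ℕ) → ∑ˡ (allFin n) f ≡ ∑ n f
  ∑ˡ-allFin n = ∑ˡ-tabulate (λ i → i)

  ∑ˡ-∑-comm : (xs : List A) (n : ℕ) (f : A → Fin n → ℕ) →
              ∑ˡ xs (λ x → ∑ n (f x)) ≡ ∑ n (λ i → ∑ˡ xs (λ x → f x i))
  ∑ˡ-∑-comm xs n f = begin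
    ∑ˡ xs (λ x → ∑ n (f x))                   ≡⟨ ∑ˡ-cong xs (sym ∘ ∑ˡ-allFin n ∘ f) ⟩
    ∑ˡ xs (λ x → ∑ˡ (allFin n) (f x))         ≡⟨ ∑ˡ-comm xs (allFin n) f ⟩
    ∑ˡ (allFin n) (λ i → ∑ˡ xs (λ x → f x i)) ≡⟨ ∑ˡ-allFin n _ ⟩
    ∑ n (λ i → ∑ˡ xs (λ x → f x i))           ∎

  ∑< : ℕ → (ℕ → ℕ) → ℕ
  ∑< zero    f = 0
  ∑< (suc k) f = f 0 + ∑< k (f ∘ suc)

  ∑<-cong : ∀ k {f g : ℕ → ℕ} → (∀ d → f d ≡ g d) → ∑< k f ≡ ∑< k g
  ∑<-cong zero    f≗g = refl
  ∑<-cong (suc k) f≗g = cong₂ _+_ (f≗g 0) (∑<-cong k (f≗g ∘ suc))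

  ∑<-zero : ∀ k → ∑< k (λ _ → 0) ≡ 0
  ∑<-zero zero    = refl
  ∑<-zero (suc k) = ∑<-zero k

  ∑<-if-zero : ∀ k (c : ℕ → Bool) (f : ℕ → ℕ) → (∀ d → f d ≡ 0) →
               ∑< k (λ d → if c d then f d else 0) ≡ 0
  ∑<-if-zero k c f f≡0 =
    trans (∑<-cong k (λ d → trans (cong (λ x → if c d then x else 0) (f≡0 d)) (if-eta (c d))))
          (∑<-zero k)

  ∑ˡ-∑<-comm : (xs : List A) (k : ℕ) (f : A → ℕ → ℕ) →
               ∑ˡ xs (λ x → ∑< k (f x)) ≡ ∑< k (λ d → ∑ˡ xs (λ x → f x d))
  ∑ˡ-∑<-comm xs zero    f = ∑ˡ-zero xs
  ∑ˡ-∑<-comm xs (suc k) f =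
    trans (∑ˡ-distrib-+ xs _ _) (cong (∑ˡ xs (λ x → f x 0) +_) (∑ˡ-∑<-comm xs k (λ x → f x ∘ suc)))

  -- Both sides sum f d over d < min k m.
  ∑<-min-comm : ∀ k m (f : ℕ → ℕ) →
                ∑< k (λ d → if d <ᵇ m then f d else 0) ≡ ∑< m (λ d → if d <ᵇ k then f d else 0)
  ∑<-min-comm zero    m       f = sym (∑<-zero m)
  ∑<-min-comm (suc k) zero    f = ∑<-zero (suc k)
  ∑<-min-comm (suc k) (suc m) f = cong (f 0 +_) (∑<-min-comm k m (f ∘ suc))

  rank : (Fin t → Bool) → Fin t → ℕ
  rank {t} β p = ∑ t (λ b → 𝟙 (does (b <? p) ∧ β b))

  ∑-by-rank : (β : Fin t → Bool) (f : ℕ → ℕ) →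
              ∑ t (λ p → if β p then f (rank β p) else 0) ≡ ∑< (∑ t (𝟙 ∘ β)) f
  ∑-by-rank {zero}  β f = refl
  ∑-by-rank {suc t} β f =
    trans (cong (_+ ∑ t (λ p → if β (suc p) then f (rank β (suc p)) else 0))
                (cong (λ r → if β zero then f r else 0) (∑-zero t)))
          (by-first (β zero))
    where
    by-first : ∀ b →
      (if b then f 0 else 0) + ∑ t (λ p → if β (suc p) then f (𝟙 b + rank (β ∘ suc) p) else 0) ≡
      ∑< (𝟙 b + ∑ t (𝟙 ∘ β ∘ suc)) f
    by-first true  = cong (f 0 +_) (∑-by-rank (β ∘ suc) (f ∘ suc))
    by-first false = ∑-by-rank (β ∘ suc) f

  +-≡ᵇ : ∀ d x w → (d + x ≡ᵇ w) ≡ (d <ᵇ suc w) ∧ (x ≡ᵇ w ∸ d)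
  +-≡ᵇ zero    x w       = refl
  +-≡ᵇ (suc d) x zero    = refl
  +-≡ᵇ (suc d) x (suc w) = +-≡ᵇ d x w

  and-tabulate : (n : ℕ) {P : Pred (Fin n) 0ℓ} (P? : Decidable P) →
                 and (tabulate (does ∘ P?)) ≡ does (all? P?)
  and-tabulate zero    P? = refl
  and-tabulate (suc n) P? = cong (does (P? zero) ∧_) (and-tabulate n (P? ∘ suc))

  does≡true⇒ : {P : Set} (P? : Dec P) → does P? ≡ true → P
  does≡true⇒ (yes p) _ = p

  Enumeration : DecidableEquality A → List A → Set
  Enumeration _≟ᴬ_ xs = ∀ a → countᵇ (λ x → does (x ≟ᴬ a)) xs ≡ 1

  ∑ˡ-if-countᵇ≡0 : (p : A → Bool) (f : A → ℕ) (xs : List A) →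
                   countᵇ p xs ≡ 0 → ∑ˡ xs (λ x → if p x then f x else 0) ≡ 0
  ∑ˡ-if-countᵇ≡0 p f []       _ = refl
  ∑ˡ-if-countᵇ≡0 p f (x ∷ xs) c with p x
  ... | false = ∑ˡ-if-countᵇ≡0 p f xs c

  ∑ˡ-δ : (_≟ᴬ_ : DecidableEquality A) (xs : List A) (a : A) (f : A → ℕ) →
         countᵇ (λ x → does (x ≟ᴬ a)) xs ≡ 1 →
         ∑ˡ xs (λ x → if does (x ≟ᴬ a) then f x else 0) ≡ f a
  ∑ˡ-δ _≟ᴬ_ (x ∷ xs) a f c with x ≟ᴬ a
  ... | yes refl = trans (cong (f x +_) (∑ˡ-if-countᵇ≡0 _ f xs (cong pred c))) (+-identityʳ (f x))
  ... | no _     = ∑ˡ-δ _≟ᴬ_ xs a f c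

  countᵇ-bijection : (_≟ᴬ_ : DecidableEquality A) (_≟ᴮ_ : DecidableEquality B)
    (xs : List A) (ys : List B) → Enumeration _≟ᴬ_ xs → Enumeration _≟ᴮ_ ys →
    {p : A → Bool} {q : B → Bool} (f : A → B) (g : B → A) →
    (∀ a → p a ≡ true → q (f a) ≡ true) → (∀ b → q b ≡ true → p (g b) ≡ true) →
    (∀ a → p a ≡ true → g (f a) ≡ a) → (∀ b → q b ≡ true → f (g b) ≡ b) →
    countᵇ p xs ≡ countᵇ q ys
  countᵇ-bijection {A = A} {B = B} _≟ᴬ_ _≟ᴮ_ xs ys enum-xs enum-ys {p} {q} f g pq qp gf fg = begin
    ∑ˡ xs (λ a → 𝟙 (p a))               ≡⟨ ∑ˡ-cong xs (sym ∘ hits-f) ⟩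
    ∑ˡ xs (λ a → ∑ˡ ys (λ b → hit b a)) ≡⟨ ∑ˡ-comm xs ys _ ⟩
    ∑ˡ ys (λ b → ∑ˡ xs (hit b))         ≡⟨ ∑ˡ-cong ys preimages ⟩
    ∑ˡ ys (λ b → 𝟙 (q b))               ∎
    where
    hit : B → A → ℕ
    hit b a = if does (b ≟ᴮ f a) then 𝟙 (p a) else 0

    hits-f : ∀ a → ∑ˡ ys (λ b → hit b a) ≡ 𝟙 (p a)
    hits-f a = ∑ˡ-δ _≟ᴮ_ ys (f a) _ (enum-ys (f a))

    hit-g : ∀ b → q b ≡ true → ∀ a → hit b a ≡ (if does (a ≟ᴬ g b) then 1 else 0)
    hit-g b qb a with a ≟ᴬ g b | b ≟ᴮ f a
    ... | yes refl | yes _     = cong 𝟙 (qp b qb)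
    ... | yes refl | no b≢fgb  = contradiction (sym (fg b qb)) b≢fgb
    ... | no _     | no _      = refl
    ... | no a≢gb  | yes refl with p a in pa
    ...   | true  = contradiction (sym (gf a pa)) a≢gb
    ...   | false = refl

    no-hit : ∀ b → q b ≡ false → ∀ a → hit b a ≡ 0
    no-hit b qb a with b ≟ᴮ f a
    ... | no _     = refl
    ... | yes refl with p a in pa
    ...   | true  = contradiction (trans (sym (pq a pa)) qb) λ ()
    ...   | false = refl

    preimages : ∀ b → ∑ˡ xs (hit b) ≡ 𝟙 (q b)
    preimages b with q b in qb
    ... | true  = trans (∑ˡ-cong xs (hit-g b qb)) (∑ˡ-δ _≟ᴬ_ xs (g b) _ (enum-xs (g b)))
    ... | false = trans (∑ˡ-cong xs (no-hit b qb)) (∑ˡ-zero xs)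

  countᵇ-allVecs-suc : ∀ k m (p : Vec (Fin k) (suc m) → Bool) →
    countᵇ p (allVecs k (suc m)) ≡ ∑ k (λ x → countᵇ (λ w → p (x ∷ w)) (allVecs k m))
  countᵇ-allVecs-suc k m p = begin
    countᵇ p (concatMap (λ x → map (x ∷_) (allVecs k m)) (allFin k))
      ≡⟨ ∑ˡ-concatMap _ (allFin k) _ ⟩
    ∑ˡ (allFin k) (λ x → ∑ˡ (map (x ∷_) (allVecs k m)) (λ v → 𝟙 (p v)))
      ≡⟨ ∑ˡ-cong (allFin k) (λ x → ∑ˡ-map (x ∷_) (allVecs k m) _) ⟩
    ∑ˡ (allFin k) (λ x → countᵇ (λ w → p (x ∷ w)) (allVecs k m))
      ≡⟨ ∑ˡ-allFin k _ ⟩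
    ∑ k (λ x → countᵇ (λ w → p (x ∷ w)) (allVecs k m)) ∎

  allVecs-enumeration : ∀ k m → Enumeration (≡-dec _≟_) (allVecs k m)
  allVecs-enumeration k zero    []      = refl
  allVecs-enumeration k (suc m) (y ∷ a) = begin
    countᵇ (λ v → does (≡-dec _≟_ v (y ∷ a))) (allVecs k (suc m))
      ≡⟨ countᵇ-allVecs-suc k m _ ⟩
    ∑ k (λ x → countᵇ (λ w → does (x ≟ y) ∧ does (≡-dec _≟_ w a)) (allVecs k m))
      ≡⟨ ∑-cong k (λ x → tails (does (x ≟ y))) ⟩
    ∑ k (λ x → 𝟙 (does (x ≟ y)))
      ≡⟨ ∑-δ k y 1 ⟩
    1 ∎
    where
    tails : ∀ b → countᵇ (λ w → b ∧ does (≡-dec _≟_ w a)) (allVecs k m) ≡ 𝟙 b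
    tails true  = allVecs-enumeration k m a
    tails false = ∑ˡ-zero (allVecs k m)

module PartialMatchings where

  open import Data.Bool.ListAction using (and)
  open import Data.Bool.Properties using (∧-zeroʳ; ∧-conicalˡ; ∧-conicalʳ)
  import Data.Bool as Bool
  open import Data.Fin.Properties using (all?; <-irrefl; <-asym)
  open import Data.List using (map; concatMap; filter; length; tabulate; allFin)
  open import Data.List.Properties using (map-tabulate) renaming (tabulate-cong to tabulateˡ-cong)
  open import Data.Nat using (_+_; _*_; _∸_; _<ᵇ_; _≡ᵇ_)
  import Data.Nat.Properties as ℕ
  open import Data.Product using (_×_; _,_; proj₁; proj₂; uncurry)
  open import Data.Vec using (_∷_) renaming (tabulate to tabulateᵛ)
  open import Data.Vec.Properties using (≡-dec; lookup∘tabulate; tabulate∘lookup; tabulate-cong)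
  open import Function using (_⇔_; mk⇔)
  open import Relation.Nullary using (¬_; contradiction)
  open import Relation.Nullary.Decidable
    using (⌊_⌋; ¬?; _×-dec_; isYes≗does; dec-true; dec-false; does-⇔)

  open Counting

  private variable
    t : ℕ

  IsInvolution : (Fin t → Fin t) → Set
  IsInvolution φ = ∀ i → φ (φ i) ≡ i

  involution? : (φ : Fin t → Fin t) → Dec (IsInvolution φ)
  involution? φ = all? (λ i → φ (φ i) ≟ i)

  isOpen : (Fin t → Fin t) → Fin t → Bool
  isOpen φ i = does (φ i ≟ i)

  #open : (Fin t → Fin t) → ℕ
  #open {t} φ = ∑ t (λ i → 𝟙 (isOpen φ i))

  crossᵇ : (Fin t → Fin t) → Fin t → Fin t → Bool
  crossᵇ φ a b = does (a <? b) ∧ does (b <? φ a) ∧ does (φ a <? φ b)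

  coverᵇ : (Fin t → Fin t) → Fin t → Fin t → Bool
  coverᵇ φ a b = does (a <? b) ∧ does (b <? φ a) ∧ isOpen φ b

  #crossings : (Fin t → Fin t) → ℕ
  #crossings {t} φ = ∑ t (λ a → ∑ t (λ b → 𝟙 (crossᵇ φ a b)))

  weight : (Fin t → Fin t) → ℕ
  weight {t} φ = ∑ t (λ a → ∑ t (λ b → 𝟙 (crossᵇ φ a b) + 𝟙 (coverᵇ φ a b)))

  isPartialMatchingᵇ : ℕ → (Fin t → Fin t) → Bool
  isPartialMatchingᵇ h φ = does (involution? φ) ∧ (#open φ ≡ᵇ h)

  isPartialᵇ : ℕ → ℕ → (Fin t → Fin t) → Bool
  isPartialᵇ h w φ = isPartialMatchingᵇ h φ ∧ (weight φ ≡ᵇ w)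

  #partials : ℕ → ℕ → ℕ → ℕ
  #partials t h w = countᵇ (λ v → isPartialᵇ h w (lookup v)) (allVecs t t)

  fixedPointFree⇔#open≡0 : (φ : Fin t → Fin t) → (∀ i → ¬ φ i ≡ i) ⇔ #open φ ≡ 0
  fixedPointFree⇔#open≡0 {t} φ = mk⇔
    (λ free → trans (∑-cong t (λ i → cong 𝟙 (dec-false (φ i ≟ i) (free i)))) (∑-zero t))
    (λ #open≡0 i φi≡i →
       ℕ.1+n≢0 (subst (λ b → 𝟙 b ≡ 0) (dec-true (φ i ≟ i) φi≡i) (∑-zero⁻ t _ #open≡0 i)))

  isMatching≡ : (v : Vec (Fin t) t) →
                isMatching v ≡ does (involution? (lookup v)) ∧ (#open (lookup v) ≡ᵇ 0)
  isMatching≡ {t} v = begin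
    and (map matchedᵇ (allFin t))
      ≡⟨ cong and (trans (map-tabulate (λ i → i) matchedᵇ) (tabulateˡ-cong matchedᵇ≡)) ⟩
    and (tabulate (does ∘ matched?))
      ≡⟨ and-tabulate t matched? ⟩
    does (all? matched?)
      ≡⟨ does-⇔ split (all? matched?) (involution? φ ×-dec all? free?) ⟩
    does (involution? φ) ∧ does (all? free?)
      ≡⟨ cong (does (involution? φ) ∧_)
              (does-⇔ (fixedPointFree⇔#open≡0 φ) (all? free?) (#open φ ℕ.≟ 0)) ⟩
    does (involution? φ) ∧ (#open φ ≡ᵇ 0) ∎
    where
    φ = lookup v
    free? : ∀ i → Dec (¬ φ i ≡ i)
    free? i = ¬? (φ i ≟ i)
    matchedᵇ : Fin t → Bool
    matchedᵇ i = ⌊ φ (φ i) ≟ i ⌋ ∧ ⌊ ¬? (φ i ≟ i) ⌋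
    matched? : ∀ i → Dec (φ (φ i) ≡ i × ¬ φ i ≡ i)
    matched? i = (φ (φ i) ≟ i) ×-dec free? i
    matchedᵇ≡ : ∀ i → matchedᵇ i ≡ does (matched? i)
    matchedᵇ≡ i = cong₂ _∧_ (isYes≗does (φ (φ i) ≟ i)) (isYes≗does (¬? (φ i ≟ i)))
    split : (∀ i → φ (φ i) ≡ i × ¬ φ i ≡ i) ⇔ (IsInvolution φ × (∀ i → ¬ φ i ≡ i))
    split = mk⇔ (λ m → proj₁ ∘ m , proj₂ ∘ m) (λ (inv , free) i → inv i , free i)

  crossings≡ : (v : Vec (Fin t) t) → crossings v ≡ #crossings (lookup v)
  crossings≡ {t} v = begin
    length (filter (λ ab → crossingᵇ ab Bool.≟ true) pairs)
      ≡⟨ length-filter≡countᵇ crossingᵇ pairs ⟩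
    countᵇ crossingᵇ pairs
      ≡⟨ ∑ˡ-concatMap _ (allFin t) _ ⟩
    ∑ˡ (allFin t) (λ a → ∑ˡ (map (a ,_) (allFin t)) (𝟙 ∘ crossingᵇ))
      ≡⟨ ∑ˡ-cong (allFin t) (λ a → trans (∑ˡ-map (a ,_) (allFin t) _) (∑ˡ-allFin t _)) ⟩
    ∑ˡ (allFin t) (λ a → ∑ t (λ b → 𝟙 (crossingᵇ (a , b))))
      ≡⟨ ∑ˡ-allFin t _ ⟩
    ∑ t (λ a → ∑ t (λ b → 𝟙 (crossingᵇ (a , b))))
      ≡⟨ ∑-cong t (λ a → ∑-cong t (λ b → cong 𝟙 (crossingPair≡crossᵇ a b))) ⟩
    #crossings (lookup v) ∎
    where
    pairs : List (Fin t × Fin t)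
    pairs = concatMap (λ a → map (a ,_) (allFin t)) (allFin t)
    crossingᵇ : Fin t × Fin t → Bool
    crossingᵇ (a , b) = crossingPair v a b
    crossingPair≡crossᵇ : ∀ a b → crossingPair v a b ≡ crossᵇ (lookup v) a b
    crossingPair≡crossᵇ a b = cong₂ _∧_ (isYes≗does (a <? b))
      (cong₂ _∧_ (isYes≗does (b <? lookup v a)) (isYes≗does (lookup v a <? lookup v b)))

  weight≡#crossings : (φ : Fin t → Fin t) → #open φ ≡ 0 → weight φ ≡ #crossings φ
  weight≡#crossings {t} φ #open≡0 = ∑-cong t (λ a → begin
    ∑ t (λ b → 𝟙 (crossᵇ φ a b) + 𝟙 (coverᵇ φ a b)) ≡⟨ ∑-distrib-+ t _ _ ⟩
    crossings-from a + ∑ t (λ b → 𝟙 (coverᵇ φ a b)) ≡⟨ cong (crossings-from a +_) (no-cover a) ⟩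
    crossings-from a + 0                             ≡⟨ ℕ.+-identityʳ _ ⟩
    crossings-from a                                 ∎)
    where
    crossings-from : Fin t → ℕ
    crossings-from a = ∑ t (λ b → 𝟙 (crossᵇ φ a b))
    closed : ∀ b → isOpen φ b ≡ false
    closed b = 𝟙≡0⇒false (∑-zero⁻ t _ #open≡0 b)
    no-cover-at : ∀ a b → 𝟙 (coverᵇ φ a b) ≡ 0
    no-cover-at a b rewrite closed b | ∧-zeroʳ (does (b <? φ a)) | ∧-zeroʳ (does (a <? b)) = refl
    no-cover : ∀ a → ∑ t (λ b → 𝟙 (coverᵇ φ a b)) ≡ 0
    no-cover a = trans (∑-cong t (no-cover-at a)) (∑-zero t)

  length-P : ∀ n k → length (P n k) ≡ #partials (2 * n) 0 k
  length-P n k = trans (length-filter≡countᵇ _ (allVecs (2 * n) (2 * n)))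
                       (∑ˡ-cong (allVecs (2 * n) (2 * n)) (cong 𝟙 ∘ matching≡partial))
    where
    matching≡partial : (v : Vec (Fin (2 * n)) (2 * n)) →
                       isMatching v ∧ (crossings v ≡ᵇ k) ≡ isPartialᵇ 0 k (lookup v)
    matching≡partial v rewrite isMatching≡ v | crossings≡ v
      with does (involution? (lookup v)) | #open (lookup v) in #open≡
    ... | false | _     = refl
    ... | true  | suc _ = refl
    ... | true  | zero  = cong (_≡ᵇ k) (sym (weight≡#crossings (lookup v) #open≡))

  predOr : Fin (suc t) → Fin t → Fin t
  predOr zero    d = d
  predOr (suc j) d = j

  -- Deleting the point 0 leaves its partner open.
  detach : (Fin (suc t) → Fin (suc t)) → Fin t → Fin t
  detach φ i = predOr (φ (suc i)) i

  attach : Fin (suc t) → (Fin t → Fin t) → Fin (suc t) → Fin (suc t)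
  attach c ψ zero    = c
  attach c ψ (suc i) = if does (suc i ≟ c) then zero else suc (ψ i)

  attachable : Fin (suc t) → (Fin t → Fin t) → Bool
  attachable zero    ψ = true
  attachable (suc p) ψ = isOpen ψ p

  isOpen⇒fixed : (ψ : Fin t → Fin t) (p : Fin t) → isOpen ψ p ≡ true → ψ p ≡ p
  isOpen⇒fixed ψ p _ with ψ p ≟ p
  ... | yes ψp≡p = ψp≡p

  involution-cong : {φ ψ : Fin t → Fin t} → (∀ i → φ i ≡ ψ i) →
                    IsInvolution φ → IsInvolution ψ
  involution-cong {φ = φ} {ψ} φ≗ψ inv i = begin
    ψ (ψ i) ≡⟨ cong ψ (sym (φ≗ψ i)) ⟩
    ψ (φ i) ≡⟨ sym (φ≗ψ (φ i)) ⟩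
    φ (φ i) ≡⟨ inv i ⟩
    i       ∎

  attach-detach : (φ : Fin (suc t) → Fin (suc t)) → IsInvolution φ →
                  ∀ i → attach (φ zero) (detach φ) i ≡ φ i
  attach-detach φ inv zero = refl
  attach-detach φ inv (suc j) with suc j ≟ φ zero
  ... | yes sj≡φ0 = trans (sym (inv zero)) (cong φ (sym sj≡φ0))
  ... | no sj≢φ0 with φ (suc j) in φsj≡
  ...   | zero  = contradiction (trans (sym (inv (suc j))) (cong φ φsj≡)) sj≢φ0
  ...   | suc k = refl

  detach-involution : (φ : Fin (suc t) → Fin (suc t)) → IsInvolution φ → IsInvolution (detach φ)
  detach-involution φ inv i with φ (suc i) in φsi≡
  ... | zero  rewrite φsi≡ = refl
  ... | suc k rewrite trans (cong φ (sym φsi≡)) (inv (suc i)) = refl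

  detach-attachable : (φ : Fin (suc t) → Fin (suc t)) → IsInvolution φ →
                      attachable (φ zero) (detach φ) ≡ true
  detach-attachable φ inv with φ zero in φ0≡
  ... | zero  = refl
  ... | suc p rewrite trans (cong φ (sym φ0≡)) (inv zero) = dec-true (p ≟ p) refl

  attach-involution : (c : Fin (suc t)) (ψ : Fin t → Fin t) → attachable c ψ ≡ true →
                      IsInvolution ψ → IsInvolution (attach c ψ)
  attach-involution zero    ψ _ inv zero    = refl
  attach-involution zero    ψ _ inv (suc i) = cong suc (inv i)
  attach-involution (suc p) ψ _ inv zero rewrite dec-true (p ≟ p) refl = refl
  attach-involution (suc p) ψ p-open inv (suc i) with i ≟ p
  ... | yes refl = refl
  ... | no i≢p with ψ i ≟ p
  ...   | yes ψi≡p =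
    contradiction (trans (sym (inv i)) (trans (cong ψ ψi≡p) (isOpen⇒fixed ψ p p-open))) i≢p
  ...   | no _     = cong suc (inv i)

  detach-attach : (c : Fin (suc t)) (ψ : Fin t → Fin t) → attachable c ψ ≡ true →
                  ∀ i → detach (attach c ψ) i ≡ ψ i
  detach-attach zero    ψ _      i = refl
  detach-attach (suc p) ψ p-open i with i ≟ p
  ... | yes refl = sym (isOpen⇒fixed ψ i p-open)
  ... | no _     = refl

  involution-attach≡ : (c : Fin (suc t)) (ψ : Fin t → Fin t) → attachable c ψ ≡ true →
                       does (involution? (attach c ψ)) ≡ does (involution? ψ)
  involution-attach≡ c ψ c-ok =
    does-⇔ (mk⇔ detached (attach-involution c ψ c-ok)) (involution? (attach c ψ)) (involution? ψ)
    where
    detached : IsInvolution (attach c ψ) → IsInvolution ψ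
    detached = involution-cong (detach-attach c ψ c-ok) ∘ detach-involution (attach c ψ)

  #open-attach-suc : (p : Fin t) (ψ : Fin t → Fin t) → isOpen ψ p ≡ true →
                     #open ψ ≡ suc (#open (attach (suc p) ψ))
  #open-attach-suc {t} p ψ p-open = begin
    ∑ t (λ i → 𝟙 (isOpen ψ i))                                         ≡⟨ ∑-cong t split ⟩
    ∑ t (λ i → 𝟙 (isOpen φ (suc i)) + (if does (i ≟ p) then 1 else 0)) ≡⟨ ∑-distrib-+ t _ _ ⟩
    #open φ + ∑ t (λ i → if does (i ≟ p) then 1 else 0)   ≡⟨ cong (#open φ +_) (∑-δ t p 1) ⟩
    #open φ + 1                                           ≡⟨ ℕ.+-comm (#open φ) 1 ⟩
    suc (#open φ)                                         ∎
    where
    φ = attach (suc p) ψ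
    split : ∀ i → 𝟙 (isOpen ψ i) ≡ 𝟙 (isOpen φ (suc i)) + (if does (i ≟ p) then 1 else 0)
    split i with i ≟ p
    ... | yes refl = cong 𝟙 p-open
    ... | no _     = sym (ℕ.+-identityʳ _)

  <ᵇ-irrefl : (a : Fin t) → does (a <? a) ≡ false
  <ᵇ-irrefl a = dec-false (a <? a) (<-irrefl refl)

  <ᵇ-asym : (a b : Fin t) → does (a <? b) ∧ does (b <? a) ≡ false
  <ᵇ-asym a b = dec-false ((a <? b) ×-dec (b <? a)) (uncurry <-asym)

  weight-attach-zero : (ψ : Fin t → Fin t) → weight (attach zero ψ) ≡ weight ψ
  weight-attach-zero {t} ψ = cong₂ _+_ (∑-zero t) refl

  -- The new chord from 0 to p + 1 crosses the chords of ψ passing over p, and passes over the open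
  -- points left of p; the open point p itself disappears.
  weight-attach-suc : (p : Fin t) (ψ : Fin t → Fin t) → isOpen ψ p ≡ true →
                      weight (attach (suc p) ψ) ≡ rank (isOpen ψ) p + weight ψ
  weight-attach-suc {t} p ψ p-open = begin
    ∑ t (λ b → pair φ zero (suc b)) + inner ≡⟨ cong (_+ inner) first-row-sum ⟩
    (∑ t over-p + r) + inner                ≡⟨ cong (_+ inner) (ℕ.+-comm (∑ t over-p) r) ⟩
    (r + ∑ t over-p) + inner                ≡⟨ ℕ.+-assoc r (∑ t over-p) inner ⟩
    r + (∑ t over-p + inner)                ≡⟨ cong (r +_) (ℕ.+-comm (∑ t over-p) inner) ⟩
    r + (inner + ∑ t over-p)                ≡⟨ cong (r +_) (sym (∑-distrib-+ t _ over-p)) ⟩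
    r + ∑ t (λ a → ∑ t (λ b → pair φ (suc a) (suc b)) + over-p a)
                                            ≡⟨ cong (r +_) (∑-cong t row) ⟩
    r + weight ψ                            ∎
    where
    φ = attach (suc p) ψ
    r = rank (isOpen ψ) p

    pair : ∀ {n} → (Fin n → Fin n) → Fin n → Fin n → ℕ
    pair χ a b = 𝟙 (crossᵇ χ a b) + 𝟙 (coverᵇ χ a b)

    inner : ℕ
    inner = ∑ t (λ a → ∑ t (λ b → pair φ (suc a) (suc b)))

    over-p : Fin t → ℕ
    over-p a = 𝟙 (does (a <? p) ∧ does (p <? ψ a))

    first-row : ∀ b → pair φ zero (suc b) ≡ over-p b + 𝟙 (does (b <? p) ∧ isOpen ψ b)
    first-row b with b ≟ p
    ... | yes refl rewrite <ᵇ-irrefl b = refl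
    ... | no _     = refl

    first-row-sum : ∑ t (λ b → pair φ zero (suc b)) ≡ ∑ t over-p + r
    first-row-sum = trans (∑-cong t first-row) (∑-distrib-+ t over-p _)

    column-p : ∀ x y z → y ∧ z ≡ false →
      𝟙 (x ∧ y ∧ false) + 𝟙 (x ∧ y ∧ false) + 𝟙 (x ∧ y) ≡
      𝟙 (x ∧ y ∧ z) + 𝟙 (x ∧ y ∧ true)
    column-p false y     z     _ = refl
    column-p true  false z     _ = refl
    column-p true  true  false _ = refl

    row-p : ∀ x y z w → x ∧ y ≡ false →
      𝟙 (x ∧ false ∧ z) + 𝟙 (x ∧ false ∧ w) + 0 ≡ 𝟙 (x ∧ y ∧ z) + 𝟙 (x ∧ y ∧ w)
    row-p false y     z w _ = refl
    row-p true  false z w _ = refl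

    cell : ∀ a b → pair φ (suc a) (suc b) + (if does (b ≟ p) then over-p a else 0) ≡ pair ψ a b
    cell a b with a ≟ p | b ≟ p
    ... | yes refl | yes refl rewrite <ᵇ-irrefl a = refl
    ... | yes refl | no _     rewrite isOpen⇒fixed ψ a p-open =
      row-p (does (a <? b)) (does (b <? a)) _ _ (<ᵇ-asym a b)
    ... | no _     | yes refl rewrite isOpen⇒fixed ψ b p-open | dec-true (b ≟ b) refl =
      column-p (does (a <? b)) (does (b <? ψ a)) (does (ψ a <? b)) (<ᵇ-asym b (ψ a))
    ... | no _     | no _     = ℕ.+-identityʳ _

    row : ∀ a → ∑ t (λ b → pair φ (suc a) (suc b)) + over-p a ≡ ∑ t (pair ψ a)
    row a = begin
      ∑ t (λ b → pair φ (suc a) (suc b)) + over-p a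
        ≡⟨ cong (∑ t (λ b → pair φ (suc a) (suc b)) +_) (sym (∑-δ t p (over-p a))) ⟩
      ∑ t (λ b → pair φ (suc a) (suc b)) + ∑ t (λ b → if does (b ≟ p) then over-p a else 0)
        ≡⟨ sym (∑-distrib-+ t _ _) ⟩
      ∑ t (λ b → pair φ (suc a) (suc b) + (if does (b ≟ p) then over-p a else 0))
        ≡⟨ ∑-cong t (cell a) ⟩
      ∑ t (pair ψ a) ∎

  isPartial-suc-attach-zero : ∀ h w (ψ : Fin t → Fin t) →
                              isPartialᵇ (suc h) w (attach zero ψ) ≡ isPartialᵇ h w ψ
  isPartial-suc-attach-zero h w ψ =
    cong₂ _∧_ (cong (_∧ (#open ψ ≡ᵇ h)) (involution-attach≡ zero ψ refl))
              (cong (_≡ᵇ w) (weight-attach-zero ψ))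

  isPartial-zero-attach-zero : ∀ w (ψ : Fin t → Fin t) → isPartialᵇ 0 w (attach zero ψ) ≡ false
  isPartial-zero-attach-zero w ψ =
    cong (_∧ (weight (attach zero ψ) ≡ᵇ w)) (∧-zeroʳ (does (involution? (attach zero ψ))))

  isPartial-attach-suc : ∀ h w (p : Fin t) (ψ : Fin t → Fin t) → isOpen ψ p ≡ true →
    isPartialᵇ h w (attach (suc p) ψ) ≡
    isPartialMatchingᵇ (suc h) ψ ∧ (rank (isOpen ψ) p + weight ψ ≡ᵇ w)
  isPartial-attach-suc h w p ψ p-open = cong₂ _∧_
    (cong₂ _∧_ (involution-attach≡ (suc p) ψ p-open)
               (cong (_≡ᵇ suc h) (sym (#open-attach-suc p ψ p-open))))
    (cong (_≡ᵇ w) (weight-attach-suc p ψ p-open))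

  #open-cong : {φ ψ : Fin t → Fin t} → (∀ i → φ i ≡ ψ i) → #open φ ≡ #open ψ
  #open-cong {t} φ≗ψ = ∑-cong t (λ i → cong (λ x → 𝟙 (does (x ≟ i))) (φ≗ψ i))

  weight-cong : {φ ψ : Fin t → Fin t} → (∀ i → φ i ≡ ψ i) → weight φ ≡ weight ψ
  weight-cong {t} {φ} {ψ} φ≗ψ = ∑-cong t (λ a → ∑-cong t (cell a))
    where
    cell : ∀ a b → 𝟙 (crossᵇ φ a b) + 𝟙 (coverᵇ φ a b) ≡
                   𝟙 (crossᵇ ψ a b) + 𝟙 (coverᵇ ψ a b)
    cell a b rewrite φ≗ψ a | φ≗ψ b = refl

  isPartialᵇ-cong : ∀ h w {φ ψ : Fin t → Fin t} → (∀ i → φ i ≡ ψ i) →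
                    isPartialᵇ h w φ ≡ isPartialᵇ h w ψ
  isPartialᵇ-cong h w {φ} {ψ} φ≗ψ =
    cong₂ _∧_ (cong₂ _∧_ involution≡ (cong (_≡ᵇ h) (#open-cong φ≗ψ))) (cong (_≡ᵇ w) (weight-cong φ≗ψ))
    where
    involution≡ : does (involution? φ) ≡ does (involution? ψ)
    involution≡ = does-⇔ (mk⇔ (involution-cong φ≗ψ) (involution-cong (sym ∘ φ≗ψ)))
                         (involution? φ) (involution? ψ)

  attachable-cong : (c : Fin (suc t)) {φ ψ : Fin t → Fin t} → (∀ i → φ i ≡ ψ i) →
                    attachable c φ ≡ attachable c ψ
  attachable-cong zero    φ≗ψ = refl
  attachable-cong (suc p) φ≗ψ = cong (λ x → does (x ≟ p)) (φ≗ψ p)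

  countᵇ-detach : ∀ h w (c : Fin (suc t)) →
    countᵇ (λ u → isPartialᵇ h w (lookup (c ∷ u))) (allVecs (suc t) t) ≡
    countᵇ (λ v → attachable c (lookup v) ∧ isPartialᵇ h w (attach c (lookup v))) (allVecs t t)
  countᵇ-detach {t} h w c =
    countᵇ-bijection (≡-dec _≟_) (≡-dec _≟_) (allVecs (suc t) t) (allVecs t t)
      (allVecs-enumeration (suc t) t) (allVecs-enumeration t t)
      delete insert delete-ok insert-ok insert-delete delete-insert
    where
    delete : Vec (Fin (suc t)) t → Vec (Fin t) t
    delete u = tabulateᵛ (detach (lookup (c ∷ u)))

    insert : Vec (Fin t) t → Vec (Fin (suc t)) t
    insert v = tabulateᵛ (attach c (lookup v) ∘ suc)

    lookup-delete : ∀ u i → lookup (delete u) i ≡ detach (lookup (c ∷ u)) i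
    lookup-delete u = lookup∘tabulate (detach (lookup (c ∷ u)))

    lookup-insert : ∀ v i → lookup (c ∷ insert v) i ≡ attach c (lookup v) i
    lookup-insert v zero    = refl
    lookup-insert v (suc i) = lookup∘tabulate (attach c (lookup v) ∘ suc) i

    involution : ∀ {n} (φ : Fin n → Fin n) → isPartialᵇ h w φ ≡ true → IsInvolution φ
    involution φ ok = does≡true⇒ (involution? φ) (∧-conicalˡ _ _ (∧-conicalˡ _ _ ok))

    attach-delete : ∀ u → IsInvolution (lookup (c ∷ u)) →
                    ∀ i → attach c (lookup (delete u)) i ≡ lookup (c ∷ u) i
    attach-delete u inv zero    = refl
    attach-delete u inv (suc i) =
      trans (cong (λ x → if does (suc i ≟ c) then zero else suc x) (lookup-delete u i))
            (attach-detach (lookup (c ∷ u)) inv (suc i))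

    delete-ok : ∀ u → isPartialᵇ h w (lookup (c ∷ u)) ≡ true →
                attachable c (lookup (delete u)) ∧ isPartialᵇ h w (attach c (lookup (delete u))) ≡ true
    delete-ok u ok = cong₂ _∧_
      (trans (attachable-cong c (lookup-delete u)) (detach-attachable (lookup (c ∷ u)) inv))
      (trans (isPartialᵇ-cong h w (attach-delete u inv)) ok)
      where inv = involution (lookup (c ∷ u)) ok

    insert-ok : ∀ v → attachable c (lookup v) ∧ isPartialᵇ h w (attach c (lookup v)) ≡ true →
                isPartialᵇ h w (lookup (c ∷ insert v)) ≡ true
    insert-ok v ok =
      trans (isPartialᵇ-cong h w (lookup-insert v)) (∧-conicalʳ (attachable c (lookup v)) _ ok)

    insert-delete : ∀ u → isPartialᵇ h w (lookup (c ∷ u)) ≡ true → insert (delete u) ≡ u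
    insert-delete u ok =
      trans (tabulate-cong (attach-delete u (involution (lookup (c ∷ u)) ok) ∘ suc)) (tabulate∘lookup u)

    delete-insert : ∀ v → attachable c (lookup v) ∧ isPartialᵇ h w (attach c (lookup v)) ≡ true →
                    delete (insert v) ≡ v
    delete-insert v ok =
      trans (tabulate-cong (λ i → trans (cong (λ x → predOr x i) (lookup-insert v (suc i)))
                                        (detach-attach c (lookup v) c-ok i)))
            (tabulate∘lookup v)
      where c-ok = ∧-conicalˡ (attachable c (lookup v)) _ ok

  ∑-attach-suc : ∀ h w (ψ : Fin t → Fin t) →
    ∑ t (λ p → 𝟙 (isOpen ψ p ∧ isPartialᵇ h w (attach (suc p) ψ))) ≡
    ∑< (suc h) (λ d → 𝟙 (isPartialMatchingᵇ (suc h) ψ ∧ (d + weight ψ ≡ᵇ w)))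
  ∑-attach-suc {t} h w ψ = begin
    ∑ t (λ p → 𝟙 (isOpen ψ p ∧ isPartialᵇ h w (attach (suc p) ψ))) ≡⟨ ∑-cong t summand ⟩
    ∑ t (λ p → if isOpen ψ p then g (rank (isOpen ψ) p) else 0)   ≡⟨ ∑-by-rank (isOpen ψ) g ⟩
    ∑< (#open ψ) g                                                ≡⟨ open-count ⟩
    ∑< (suc h) g                                                  ∎
    where
    g : ℕ → ℕ
    g d = 𝟙 (isPartialMatchingᵇ (suc h) ψ ∧ (d + weight ψ ≡ᵇ w))

    summand : ∀ p → 𝟙 (isOpen ψ p ∧ isPartialᵇ h w (attach (suc p) ψ)) ≡
                    (if isOpen ψ p then g (rank (isOpen ψ) p) else 0)
    summand p with isOpen ψ p in p-open
    ... | true  = cong 𝟙 (isPartial-attach-suc h w p ψ p-open)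
    ... | false = refl

    open-count : ∑< (#open ψ) g ≡ ∑< (suc h) g
    open-count with #open ψ ℕ.≟ suc h
    ... | yes #open≡ = cong (λ k → ∑< k g) #open≡
    ... | no  #open≢ = trans (vanishing (#open ψ)) (sym (vanishing (suc h)))
      where
      wrong-count : (#open ψ ≡ᵇ suc h) ≡ false
      wrong-count = dec-false (#open ψ ℕ.≟ suc h) #open≢
      vanish : ∀ d → g d ≡ 0
      vanish d rewrite wrong-count | ∧-zeroʳ (does (involution? ψ)) = refl
      vanishing : ∀ k → ∑< k g ≡ 0
      vanishing k = trans (∑<-cong k vanish) (∑<-zero k)

  countᵇ-weight-shift : ∀ t h w d →
    countᵇ (λ v → isPartialMatchingᵇ h (lookup v) ∧ (d + weight (lookup v) ≡ᵇ w)) (allVecs t t) ≡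
    (if d <ᵇ suc w then #partials t h (w ∸ d) else 0)
  countᵇ-weight-shift t h w d = trans (∑ˡ-cong xs (cong 𝟙 ∘ split)) (in-range (d <ᵇ suc w))
    where
    xs = allVecs t t
    shape : Vec (Fin t) t → Bool
    shape v = isPartialMatchingᵇ h (lookup v)
    split : ∀ v → shape v ∧ (d + weight (lookup v) ≡ᵇ w) ≡
                  shape v ∧ (d <ᵇ suc w) ∧ (weight (lookup v) ≡ᵇ w ∸ d)
    split v = cong (shape v ∧_) (+-≡ᵇ d (weight (lookup v)) w)
    in-range : ∀ b → countᵇ (λ v → shape v ∧ b ∧ (weight (lookup v) ≡ᵇ w ∸ d)) xs ≡
                     (if b then #partials t h (w ∸ d) else 0)
    in-range true  = refl
    in-range false = trans (∑ˡ-cong xs (λ v → cong 𝟙 (∧-zeroʳ (shape v)))) (∑ˡ-zero xs)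

  attached-at : ℕ → ℕ → Fin t → Vec (Fin t) t → Bool
  attached-at h w p v = isOpen (lookup v) p ∧ isPartialᵇ h w (attach (suc p) (lookup v))

  countᵇ-attach-suc : ∀ t h w → ∑ t (λ p → countᵇ (attached-at h w p) (allVecs t t)) ≡
                                ∑< (suc w) (λ d → if d <ᵇ suc h then #partials t (suc h) (w ∸ d) else 0)
  countᵇ-attach-suc t h w = begin
    ∑ t (λ p → countᵇ (attached-at h w p) xs)
      ≡⟨ sym (∑ˡ-∑-comm xs t _) ⟩
    ∑ˡ xs (λ v → ∑ t (λ p → 𝟙 (attached-at h w p v)))
      ≡⟨ ∑ˡ-cong xs (∑-attach-suc h w ∘ lookup) ⟩
    ∑ˡ xs (λ v → ∑< (suc h) (λ d → 𝟙 (shifted d v)))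
      ≡⟨ ∑ˡ-∑<-comm xs (suc h) (λ v d → 𝟙 (shifted d v)) ⟩
    ∑< (suc h) (λ d → countᵇ (shifted d) xs)
      ≡⟨ ∑<-cong (suc h) (countᵇ-weight-shift t (suc h) w) ⟩
    ∑< (suc h) (λ d → if d <ᵇ suc w then #partials t (suc h) (w ∸ d) else 0)
      ≡⟨ ∑<-min-comm (suc h) (suc w) (λ d → #partials t (suc h) (w ∸ d)) ⟩
    ∑< (suc w) (λ d → if d <ᵇ suc h then #partials t (suc h) (w ∸ d) else 0) ∎
    where
    xs = allVecs t t
    shifted : ℕ → Vec (Fin t) t → Bool
    shifted d v = isPartialMatchingᵇ (suc h) (lookup v) ∧ (d + weight (lookup v) ≡ᵇ w)

  #partials-suc : ∀ t h w → #partials (suc t) h w ≡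
    countᵇ (λ v → isPartialᵇ h w (attach zero (lookup v))) (allVecs t t) +
    ∑< (suc w) (λ d → if d <ᵇ suc h then #partials t (suc h) (w ∸ d) else 0)
  #partials-suc t h w = begin
    #partials (suc t) h w
      ≡⟨ countᵇ-allVecs-suc (suc t) t _ ⟩
    ∑ (suc t) (λ c → countᵇ (λ u → isPartialᵇ h w (lookup (c ∷ u))) (allVecs (suc t) t))
      ≡⟨ ∑-cong (suc t) (countᵇ-detach h w) ⟩
    first-open + ∑ t (λ p → countᵇ (attached-at h w p) xs)
      ≡⟨ cong (first-open +_) (countᵇ-attach-suc t h w) ⟩
    first-open + ∑< (suc w) (λ d → if d <ᵇ suc h then #partials t (suc h) (w ∸ d) else 0) ∎
    where
    xs = allVecs t t
    first-open = countᵇ (λ v → isPartialᵇ h w (attach zero (lookup v))) xs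

  -- The first point is open, or matched with the open point of rank d of the rest, which adds d to the weight.
  partials : ℕ → ℕ → ℕ → ℕ
  partials zero    h       w = 𝟙 ((0 ≡ᵇ h) ∧ (0 ≡ᵇ w))
  partials (suc t) zero    w = partials t 1 w
  partials (suc t) (suc h) w =
    partials t h w + ∑< (suc w) (λ d → if d <ᵇ suc (suc h) then partials t (suc (suc h)) (w ∸ d) else 0)

  #partials≡partials : ∀ t h w → #partials t h w ≡ partials t h w
  #partials≡partials zero    h       w = ℕ.+-identityʳ _
  #partials≡partials (suc t) zero    w = begin
    #partials (suc t) 0 w
      ≡⟨ #partials-suc t 0 w ⟩
    countᵇ (λ v → isPartialᵇ 0 w (attach zero (lookup v))) xs + (#partials t 1 w + ∑< w (λ _ → 0))
      ≡⟨ cong₂ _+_ first-not-open (trans (cong (#partials t 1 w +_) (∑<-zero w)) (ℕ.+-identityʳ _)) ⟩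
    #partials t 1 w
      ≡⟨ #partials≡partials t 1 w ⟩
    partials t 1 w ∎
    where
    xs = allVecs t t
    first-not-open : countᵇ (λ v → isPartialᵇ 0 w (attach zero (lookup v))) xs ≡ 0
    first-not-open = trans (∑ˡ-cong xs (cong 𝟙 ∘ isPartial-zero-attach-zero w ∘ lookup)) (∑ˡ-zero xs)
  #partials≡partials (suc t) (suc h) w = begin
    #partials (suc t) (suc h) w
      ≡⟨ #partials-suc t (suc h) w ⟩
    countᵇ (λ v → isPartialᵇ (suc h) w (attach zero (lookup v))) xs + ∑< (suc w) (first-matched #partials)
      ≡⟨ cong₂ _+_ (trans first-open (#partials≡partials t h w)) (∑<-cong (suc w) first-matched≡) ⟩
    partials t h w + ∑< (suc w) (first-matched partials) ∎
    where
    xs = allVecs t t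
    first-open : countᵇ (λ v → isPartialᵇ (suc h) w (attach zero (lookup v))) xs ≡ #partials t h w
    first-open = ∑ˡ-cong xs (cong 𝟙 ∘ isPartial-suc-attach-zero h w ∘ lookup)
    first-matched : (ℕ → ℕ → ℕ → ℕ) → ℕ → ℕ
    first-matched count d = if d <ᵇ suc (suc h) then count t (suc (suc h)) (w ∸ d) else 0
    first-matched≡ : ∀ d → first-matched #partials d ≡ first-matched partials d
    first-matched≡ d =
      cong (λ x → if d <ᵇ suc (suc h) then x else 0) (#partials≡partials t (suc (suc h)) (w ∸ d))

module ClosedForms where

  open import Data.Integer using (ℤ; +_; _+_; _*_; _-_; -_; _⊖_)
  import Data.Integer.Properties as ℤ
  open import Data.Integer.Tactic.RingSolver using (solve-∀; solve)
  open import Data.Nat as ℕ using (_<ᵇ_; _∸_)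
  import Data.Nat.Properties as ℕ
  open import Data.Nat.Combinatorics using (_C_; nC1≡n; nCk+nC[k+1]≡[n+1]C[k+1])

  open Counting using (𝟙; ∑<-if-zero)
  open PartialMatchings using (partials)

  by-relation : ∀ {L R A B : ℤ} → A ≡ B → ∀ c → L ≡ R + c * (A - B) → L ≡ R
  by-relation {R = R} {A} refl c L≡ = trans L≡ (cancel R c A)
    where
    cancel : ∀ R c A → R + c * (A - A) ≡ R
    cancel = solve-∀

  *-C-absorb : ∀ n k → suc k ℕ.* (suc n C suc k) ≡ suc n ℕ.* (n C k)
  *-C-absorb zero    zero    = refl
  *-C-absorb zero    (suc k) = ℕ.*-zeroʳ (suc (suc k))
  *-C-absorb (suc n) zero    = trans (ℕ.*-identityˡ _) (trans (nC1≡n (suc (suc n))) (sym (ℕ.*-identityʳ _)))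
  *-C-absorb (suc n) (suc k) = begin
    suc (suc k) ℕ.* (suc (suc n) C suc (suc k))
      ≡⟨ cong (suc (suc k) ℕ.*_) (sym (nCk+nC[k+1]≡[n+1]C[k+1] (suc n) (suc k))) ⟩
    suc (suc k) ℕ.* (suc n C suc k ℕ.+ suc n C suc (suc k))
      ≡⟨ ℕ.*-distribˡ-+ (suc (suc k)) (suc n C suc k) _ ⟩
    suc n C suc k ℕ.+ suc k ℕ.* (suc n C suc k) ℕ.+ suc (suc k) ℕ.* (suc n C suc (suc k))
      ≡⟨ cong₂ (λ x y → suc n C suc k ℕ.+ x ℕ.+ y) (*-C-absorb n k) (*-C-absorb n (suc k)) ⟩
    suc n C suc k ℕ.+ suc n ℕ.* (n C k) ℕ.+ suc n ℕ.* (n C suc k)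
      ≡⟨ ℕ.+-assoc (suc n C suc k) _ _ ⟩
    suc n C suc k ℕ.+ (suc n ℕ.* (n C k) ℕ.+ suc n ℕ.* (n C suc k))
      ≡⟨ cong (suc n C suc k ℕ.+_) (sym (ℕ.*-distribˡ-+ (suc n) (n C k) _)) ⟩
    suc n C suc k ℕ.+ suc n ℕ.* (n C k ℕ.+ n C suc k)
      ≡⟨ cong (λ x → suc n C suc k ℕ.+ suc n ℕ.* x) (nCk+nC[k+1]≡[n+1]C[k+1] n k) ⟩
    suc (suc n) ℕ.* (suc n C suc k) ∎

  -- C(T, j - m), encoded so that C⁻ T (suc j) (suc m) reduces to C⁻ T j m.
  C⁻ : ℕ → ℕ → ℕ → ℤ
  C⁻ T j m = if j <ᵇ m then + 0 else + (T C (j ∸ m))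

  C⁻≡binom : ∀ T j m → C⁻ T j m ≡ + binom T (j ⊖ m)
  C⁻≡binom T j       zero    = refl
  C⁻≡binom T zero    (suc m) = refl
  C⁻≡binom T (suc j) (suc m) rewrite ℤ.[1+m]⊖[1+n]≡m⊖n j m = C⁻≡binom T j m

  C⁻-pascal : ∀ N j m → C⁻ (suc N) (suc j) m ≡ C⁻ N (suc j) m + C⁻ N j m
  C⁻-pascal N j zero = begin
    + (suc N C suc j)         ≡⟨ cong +_ (sym (nCk+nC[k+1]≡[n+1]C[k+1] N j)) ⟩
    + (N C j ℕ.+ N C suc j)   ≡⟨ cong +_ (ℕ.+-comm (N C j) _) ⟩
    + (N C suc j ℕ.+ N C j)   ≡⟨ ℤ.pos-+ (N C suc j) (N C j) ⟩
    + (N C suc j) + + (N C j) ∎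
  C⁻-pascal N zero    (suc zero)    = refl
  C⁻-pascal N zero    (suc (suc m)) = refl
  C⁻-pascal N (suc j) (suc m)       = C⁻-pascal N j m

  C⁻-ratio : ∀ N j m → (j ⊖ m) * C⁻ N j m ≡ (+ N - (j ⊖ m) + + 1) * C⁻ N j (suc m)
  C⁻-ratio N zero    zero    = sym (ℤ.*-zeroʳ (+ N - + 0 + + 1))
  C⁻-ratio N zero    (suc m) = trans (ℤ.*-zeroʳ (0 ⊖ suc m)) (sym (ℤ.*-zeroʳ (+ N - (0 ⊖ suc m) + + 1)))
  C⁻-ratio N (suc k) zero    = from-absorption (+ N) (+ k) (+ (N C k)) (+ (N C suc k)) absorption
    where
    from-absorption : ∀ N K X₀ X₁ → (+ 1 + K) * X₁ + (+ 1 + K) * X₀ ≡ (+ 1 + N) * X₀ →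
                      (+ 1 + K) * X₁ ≡ (N - (+ 1 + K) + + 1) * X₀
    from-absorption N K X₀ X₁ e = by-relation e (+ 1) (solve (N ∷ K ∷ X₀ ∷ X₁ ∷ []))

    absorption : + suc k * + (N C suc k) + + suc k * + (N C k) ≡ + suc N * + (N C k)
    absorption = begin
      + suc k * + (N C suc k) + + suc k * + (N C k)
        ≡⟨ sym (cong₂ _+_ (ℤ.pos-* (suc k) (N C suc k)) (ℤ.pos-* (suc k) (N C k))) ⟩
      + (suc k ℕ.* (N C suc k)) + + (suc k ℕ.* (N C k))
        ≡⟨ sym (ℤ.pos-+ (suc k ℕ.* (N C suc k)) _) ⟩
      + (suc k ℕ.* (N C suc k) ℕ.+ suc k ℕ.* (N C k))
        ≡⟨ cong +_ (sym (ℕ.*-distribˡ-+ (suc k) (N C suc k) (N C k))) ⟩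
      + (suc k ℕ.* (N C suc k ℕ.+ N C k))
        ≡⟨ cong (λ x → + (suc k ℕ.* x)) (trans (ℕ.+-comm (N C suc k) (N C k))
                                               (nCk+nC[k+1]≡[n+1]C[k+1] N k)) ⟩
      + (suc k ℕ.* (suc N C suc k))
        ≡⟨ cong +_ (*-C-absorb N k) ⟩
      + (suc N ℕ.* (N C k))
        ≡⟨ ℤ.pos-* (suc N) (N C k) ⟩
      + suc N * + (N C k) ∎
  C⁻-ratio N (suc j) (suc m) rewrite ℤ.[1+m]⊖[1+n]≡m⊖n j m = C⁻-ratio N j m

  partials-overfull : ∀ t k w → partials t (suc (t ℕ.+ k)) w ≡ 0
  partials-overfull zero    k w = refl
  partials-overfull (suc t) k w =
    cong₂ ℕ._+_ (partials-overfull t k w) (∑<-if-zero (suc w) (λ d → d <ᵇ 3 ℕ.+ (t ℕ.+ k)) _ overfull)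
    where
    size : t ℕ.+ suc (suc k) ≡ 2 ℕ.+ (t ℕ.+ k)
    size = trans (ℕ.+-suc t (suc k)) (cong suc (ℕ.+-suc t k))
    overfull : ∀ d → partials t (3 ℕ.+ (t ℕ.+ k)) (w ∸ d) ≡ 0
    overfull d = trans (cong (λ x → partials t (suc x) (w ∸ d)) (sym size))
                       (partials-overfull t (2 ℕ.+ k) (w ∸ d))

  partials-all-open : ∀ h w → partials h h w ≡ 𝟙 (0 ℕ.≡ᵇ w)
  partials-all-open zero    w = refl
  partials-all-open (suc h) w =
    trans (cong₂ ℕ._+_ (partials-all-open h w) (∑<-if-zero (suc w) (λ d → d <ᵇ 2 ℕ.+ h) _ overfull))
          (ℕ.+-identityʳ _)
    where
    overfull : ∀ d → partials h (2 ℕ.+ h) (w ∸ d) ≡ 0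
    overfull d = trans (cong (λ x → partials h (suc x) (w ∸ d)) (ℕ.+-comm 1 h))
                       (partials-overfull h 1 (w ∸ d))

  fewer-open : ∀ m n → m ℕ.+ suc m ℕ.+ suc n ≡ suc m ℕ.+ suc m ℕ.+ n
  fewer-open m n = ℕ.+-suc (m ℕ.+ suc m) n

  more-open : ∀ m n → m ℕ.+ suc m ℕ.+ n ≡ m ℕ.+ m ℕ.+ suc n
  more-open m n = trans (cong (ℕ._+ n) (ℕ.+-suc m m)) (sym (ℕ.+-suc (m ℕ.+ m) n))

  pos-+² : ∀ a b c → + (a ℕ.+ (b ℕ.+ c)) ≡ + a + (+ b + + c)
  pos-+² a b c = trans (ℤ.pos-+ a (b ℕ.+ c)) (cong (λ x → + a + x) (ℤ.pos-+ b c))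

  pos-+³ : ∀ a b c d → + (a ℕ.+ (b ℕ.+ (c ℕ.+ d))) ≡ + a + (+ b + (+ c + + d))
  pos-+³ a b c d = trans (ℤ.pos-+ a _) (cong (λ x → + a + x) (pos-+² b c d))

  pos-+⁴ : ∀ a b c d e → + (a ℕ.+ (b ℕ.+ (c ℕ.+ (d ℕ.+ e)))) ≡ + a + (+ b + (+ c + (+ d + + e)))
  pos-+⁴ a b c d e = trans (ℤ.pos-+ a _) (cong (λ x → + a + x) (pos-+³ b c d e))

  formula₀ : ℕ → ℕ → ℤ
  formula₀ T j = C⁻ T j 0 - C⁻ T j 1

  partials-weight₀ : ∀ j h {T} → T ≡ j ℕ.+ j ℕ.+ h → + partials T h 0 ≡ formula₀ T j
  partials-weight₀ zero    h       refl = cong +_ (partials-all-open h 0)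
  partials-weight₀ (suc j) zero    {suc N} refl = begin
    + partials N 1 0         ≡⟨ partials-weight₀ j 1 (more-open j 0) ⟩
    X₀ - Y₁                  ≡⟨ add-equal X₁ X₀ Y₁ middle-symmetry ⟩
    (X₁ + X₀) - (X₀ + Y₁)    ≡⟨ sym (cong₂ _-_ (C⁻-pascal N j 0) (C⁻-pascal N j 1)) ⟩
    formula₀ (suc N) (suc j) ∎
    where
    X₁ = C⁻ N (suc j) 0
    X₀ = C⁻ N j 0
    Y₁ = C⁻ N j 1
    add-equal : ∀ X₁ X₀ Y₁ → X₁ ≡ X₀ → X₀ - Y₁ ≡ (X₁ + X₀) - (X₀ + Y₁)
    add-equal X₁ X₀ Y₁ e = by-relation e (- + 1) (solve (X₁ ∷ X₀ ∷ Y₁ ∷ []))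
    coefficient : ∀ J → J + (+ 1 + J) + + 0 - (+ 1 + J) + + 1 ≡ + 1 + J
    coefficient = solve-∀
    middle-symmetry : X₁ ≡ X₀
    middle-symmetry =
      ℤ.*-cancelˡ-≡ (+ suc j) X₁ X₀ (trans (C⁻-ratio N (suc j) 0) (cong (_* X₀) (coefficient (+ j))))
  partials-weight₀ (suc j) (suc h) {suc N} refl = begin
    + (partials N h 0 ℕ.+ (partials N (suc (suc h)) 0 ℕ.+ 0))
      ≡⟨ pos-+² (partials N h 0) (partials N (suc (suc h)) 0) 0 ⟩
    + partials N h 0 + (+ partials N (suc (suc h)) 0 + + 0)
      ≡⟨ cong₂ (λ a b → a + (b + + 0)) (partials-weight₀ (suc j) h (fewer-open j h))
                                       (partials-weight₀ j (suc (suc h)) (more-open j (suc h))) ⟩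
    (X₁ - X₀) + ((X₀ - Y₁) + + 0) ≡⟨ telescope X₁ X₀ Y₁ ⟩
    (X₁ + X₀) - (X₀ + Y₁)         ≡⟨ sym (cong₂ _-_ (C⁻-pascal N j 0) (C⁻-pascal N j 1)) ⟩
    formula₀ (suc N) (suc j)      ∎
    where
    X₁ = C⁻ N (suc j) 0
    X₀ = C⁻ N j 0
    Y₁ = C⁻ N j 1
    telescope : ∀ X₁ X₀ Y₁ → (X₁ - X₀) + ((X₀ - Y₁) + + 0) ≡ (X₁ + X₀) - (X₀ + Y₁)
    telescope = solve-∀

  formula₁ : ℕ → ℕ → ℕ → ℤ
  formula₁ T h j = + h * C⁻ T j 1 + C⁻ T j 2

  formula₁-pascal : ∀ N h j →
    formula₁ (suc N) h (suc j) ≡ + h * (C⁻ N j 0 + C⁻ N j 1) + (C⁻ N j 1 + C⁻ N j 2)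
  formula₁-pascal N h j = cong₂ (λ x y → + h * x + y) (C⁻-pascal N j 1) (C⁻-pascal N j 2)

  partials-weight₁ : ∀ j h {T} → T ≡ j ℕ.+ j ℕ.+ h → + partials T h 1 ≡ formula₁ T h j
  partials-weight₁ zero    h       refl =
    trans (cong +_ (partials-all-open h 1)) (sym (cong (_+ + 0) (ℤ.*-zeroʳ (+ h))))
  partials-weight₁ (suc j) zero    {suc N} refl = begin
    + partials N 1 1                  ≡⟨ partials-weight₁ j 1 (more-open j 0) ⟩
    + 1 * Y₁ + Y₂                     ≡⟨ regroup (C⁻ N j 0) Y₁ Y₂ ⟩
    + 0 * (C⁻ N j 0 + Y₁) + (Y₁ + Y₂) ≡⟨ sym (formula₁-pascal N 0 j) ⟩
    formula₁ (suc N) 0 (suc j)        ∎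
    where
    Y₁ = C⁻ N j 1
    Y₂ = C⁻ N j 2
    regroup : ∀ X₀ Y₁ Y₂ → + 1 * Y₁ + Y₂ ≡ + 0 * (X₀ + Y₁) + (Y₁ + Y₂)
    regroup = solve-∀
  partials-weight₁ (suc j) (suc h) {suc N} refl = begin
    + (partials N h 1 ℕ.+ (partials N H 1 ℕ.+ (partials N H 0 ℕ.+ 0)))
      ≡⟨ pos-+³ (partials N h 1) (partials N H 1) (partials N H 0) 0 ⟩
    + partials N h 1 + (+ partials N H 1 + (+ partials N H 0 + + 0))
      ≡⟨ cong₃ (partials-weight₁ (suc j) h (fewer-open j h))
               (partials-weight₁ j H (more-open j (suc h))) (partials-weight₀ j H (more-open j (suc h))) ⟩
    (+ h * X₀ + Y₁) + ((+ H * Y₁ + Y₂) + ((X₀ - Y₁) + + 0))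
      ≡⟨ regroup (+ h) X₀ Y₁ Y₂ ⟩
    + suc h * (X₀ + Y₁) + (Y₁ + Y₂)
      ≡⟨ sym (formula₁-pascal N (suc h) j) ⟩
    formula₁ (suc N) (suc h) (suc j) ∎
    where
    H = suc (suc h)
    X₀ = C⁻ N j 0
    Y₁ = C⁻ N j 1
    Y₂ = C⁻ N j 2
    cong₃ : ∀ {a b c a′ b′ c′ : ℤ} → a ≡ a′ → b ≡ b′ → c ≡ c′ →
            a + (b + (c + + 0)) ≡ a′ + (b′ + (c′ + + 0))
    cong₃ refl refl refl = refl
    regroup : ∀ h X₀ Y₁ Y₂ → (h * X₀ + Y₁) + (((+ 2 + h) * Y₁ + Y₂) + ((X₀ - Y₁) + + 0)) ≡
                             (+ 1 + h) * (X₀ + Y₁) + (Y₁ + Y₂)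
    regroup = solve-∀

  formula₂ : ℕ → ℕ → ℕ → ℤ
  formula₂ T zero    j = (+ j + + 3) * C⁻ T j 3
  formula₂ T (suc h) j = ((+ 2 + + h) * (+ 1 + + j) - + 4) * C⁻ T j 1 - + 2 * (+ 2 + + h) * C⁻ T j 2

  formula₂-pascal : ∀ N h j → formula₂ (suc N) (suc h) (suc j) ≡
    ((+ 2 + + h) * (+ 1 + + suc j) - + 4) * (C⁻ N j 0 + C⁻ N j 1)
      - + 2 * (+ 2 + + h) * (C⁻ N j 1 + C⁻ N j 2)
  formula₂-pascal N h j = cong₂ (λ x y → ((+ 2 + + h) * (+ 1 + + suc j) - + 4) * x - + 2 * (+ 2 + + h) * y)
                                (C⁻-pascal N j 1) (C⁻-pascal N j 2)

  weight₂-closing-step : ∀ N J Y₁ Y₂ Y₃ → N ≡ J + (+ 1 + J) + + 0 →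
    (J - + 1) * Y₁ ≡ (N - (J - + 1) + + 1) * Y₂ → (J - + 2) * Y₂ ≡ (N - (J - + 2) + + 1) * Y₃ →
    ((+ 2 + + 0) * (+ 1 + J) - + 4) * Y₁ - + 2 * (+ 2 + + 0) * Y₂ ≡ (+ 1 + J + + 3) * (Y₂ + Y₃)
  weight₂-closing-step N J Y₁ Y₂ Y₃ refl r₁ r₂ =
    by-relation r₁ (+ 2) (by-relation r₂ (+ 1) (solve (J ∷ Y₁ ∷ Y₂ ∷ Y₃ ∷ [])))

  weight₂-one-open-step : ∀ N J A B C X₀ Y₁ Y₂ → N ≡ J + (+ 1 + J) + + 1 →
    + 2 * A ≡ (+ 1 + J + + 3) * Y₂ →
    + 2 * B ≡ ((+ 2 + + 1) * (+ 1 + J) - + 4) * Y₁ - + 2 * (+ 2 + + 1) * Y₂ →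
    C ≡ + 2 * Y₁ + Y₂ →
    J * X₀ ≡ (N - J + + 1) * Y₁ → (J - + 1) * Y₁ ≡ (N - (J - + 1) + + 1) * Y₂ →
    + 2 * (A + (B + (C + + 0))) ≡
      ((+ 2 + + 0) * (+ 1 + (+ 1 + J)) - + 4) * (X₀ + Y₁) - + 2 * (+ 2 + + 0) * (Y₁ + Y₂)
  weight₂-one-open-step N J A B C X₀ Y₁ Y₂ refl a b refl r₀ r₁ =
    by-relation a (+ 1) (by-relation b (+ 1) (by-relation r₀ (- + 2) (by-relation r₁ (- + 1)
      (solve (J ∷ A ∷ B ∷ X₀ ∷ Y₁ ∷ Y₂ ∷ [])))))

  weight₂-open-step : ∀ N J h A B C E X₀ Y₁ Y₂ → N ≡ J + (+ 1 + J) + (+ 2 + h) →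
    + 2 * A ≡ ((+ 2 + h) * (+ 1 + (+ 1 + J)) - + 4) * X₀ - + 2 * (+ 2 + h) * Y₁ →
    + 2 * B ≡ ((+ 2 + (+ 2 + h)) * (+ 1 + J) - + 4) * Y₁ - + 2 * (+ 2 + (+ 2 + h)) * Y₂ →
    C ≡ (+ 3 + h) * Y₁ + Y₂ →
    E ≡ X₀ - Y₁ →
    J * X₀ ≡ (N - J + + 1) * Y₁ →
    + 2 * (A + (B + (C + (E + + 0)))) ≡
      ((+ 2 + (+ 1 + h)) * (+ 1 + (+ 1 + J)) - + 4) * (X₀ + Y₁) - + 2 * (+ 2 + (+ 1 + h)) * (Y₁ + Y₂)
  weight₂-open-step N J h A B C E X₀ Y₁ Y₂ refl a b refl refl r₀ =
    by-relation a (+ 1) (by-relation b (+ 1) (by-relation r₀ (- + 1)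
      (solve (J ∷ h ∷ A ∷ B ∷ X₀ ∷ Y₁ ∷ Y₂ ∷ []))))

  partials-weight₂ : ∀ j h {T} → T ≡ j ℕ.+ j ℕ.+ h → + 2 * + partials T h 2 ≡ formula₂ T h j
  partials-weight₂ zero    zero    refl = refl
  partials-weight₂ zero    (suc h) refl =
    trans (cong (λ x → + 2 * + x) (partials-all-open (suc h) 2)) (vanish (+ h))
    where
    vanish : ∀ h → + 0 ≡ ((+ 2 + h) * (+ 1 + + 0) - + 4) * + 0 - + 2 * (+ 2 + h) * + 0
    vanish = solve-∀
  partials-weight₂ (suc j) zero    {suc N} refl = begin
    + 2 * + partials N 1 2
      ≡⟨ partials-weight₂ j 1 (more-open j 0) ⟩
    formula₂ N 1 j
      ≡⟨ weight₂-closing-step (+ N) (+ j) _ _ _ refl (C⁻-ratio N j 1) (C⁻-ratio N j 2) ⟩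
    (+ suc j + + 3) * (C⁻ N j 2 + C⁻ N j 3)
      ≡⟨ sym (cong ((+ suc j + + 3) *_) (C⁻-pascal N j 3)) ⟩
    formula₂ (suc N) 0 (suc j) ∎
  partials-weight₂ (suc j) (suc zero) {suc N} refl = begin
    + 2 * + (partials N 0 2 ℕ.+ (partials N 2 2 ℕ.+ (partials N 2 1 ℕ.+ 0)))
      ≡⟨ cong (+ 2 *_) (pos-+³ (partials N 0 2) (partials N 2 2) (partials N 2 1) 0) ⟩
    + 2 * (+ partials N 0 2 + (+ partials N 2 2 + (+ partials N 2 1 + + 0)))
      ≡⟨ weight₂-one-open-step (+ N) (+ j) (+ partials N 0 2) (+ partials N 2 2) (+ partials N 2 1) _ _ _ refl
           (partials-weight₂ (suc j) 0 (fewer-open j 0)) (partials-weight₂ j 2 (more-open j 1))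
           (partials-weight₁ j 2 (more-open j 1)) (C⁻-ratio N j 0) (C⁻-ratio N j 1) ⟩
    ((+ 2 + + 0) * (+ 1 + + suc j) - + 4) * (C⁻ N j 0 + C⁻ N j 1)
      - + 2 * (+ 2 + + 0) * (C⁻ N j 1 + C⁻ N j 2)
      ≡⟨ sym (formula₂-pascal N 0 j) ⟩
    formula₂ (suc N) 1 (suc j) ∎
  partials-weight₂ (suc j) (suc (suc h)) {suc N} refl = begin
    + 2 * + (partials N (suc h) 2 ℕ.+ (partials N H 2 ℕ.+ (partials N H 1 ℕ.+ (partials N H 0 ℕ.+ 0))))
      ≡⟨ cong (+ 2 *_) (pos-+⁴ (partials N (suc h) 2) (partials N H 2) (partials N H 1) (partials N H 0) 0) ⟩
    + 2 * (+ partials N (suc h) 2 + (+ partials N H 2 + (+ partials N H 1 + (+ partials N H 0 + + 0))))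
      ≡⟨ weight₂-open-step (+ N) (+ j) (+ h) (+ partials N (suc h) 2) (+ partials N H 2) (+ partials N H 1)
           (+ partials N H 0) _ _ _ refl (partials-weight₂ (suc j) (suc h) (fewer-open j (suc h)))
           (partials-weight₂ j H (more-open j (suc (suc h)))) (partials-weight₁ j H (more-open j (suc (suc h))))
           (partials-weight₀ j H (more-open j (suc (suc h)))) (C⁻-ratio N j 0) ⟩
    ((+ 2 + + suc h) * (+ 1 + + suc j) - + 4) * (C⁻ N j 0 + C⁻ N j 1)
      - + 2 * (+ 2 + + suc h) * (C⁻ N j 1 + C⁻ N j 2)
      ≡⟨ sym (formula₂-pascal N (suc h) j) ⟩
    formula₂ (suc N) (suc (suc h)) (suc j) ∎
    where H = suc (suc (suc h))

  two-crossings : ∀ n → 2 ℕ.* partials (2 ℕ.* n) 0 2 ≡ (n ℕ.+ 3) ℕ.* binom (2 ℕ.* n) (n ⊖ 3)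
  two-crossings n = ℤ.+-injective (begin
    + (2 ℕ.* partials (2 ℕ.* n) 0 2)             ≡⟨ ℤ.pos-* 2 (partials (2 ℕ.* n) 0 2) ⟩
    + 2 * + partials (2 ℕ.* n) 0 2               ≡⟨ partials-weight₂ n 0 (sym (ℕ.+-assoc n n 0)) ⟩
    (+ n + + 3) * C⁻ (2 ℕ.* n) n 3               ≡⟨ cong ((+ n + + 3) *_) (C⁻≡binom (2 ℕ.* n) n 3) ⟩
    + (n ℕ.+ 3) * + binom (2 ℕ.* n) (n ⊖ 3)      ≡⟨ sym (ℤ.pos-* (n ℕ.+ 3) _) ⟩
    + ((n ℕ.+ 3) ℕ.* binom (2 ℕ.* n) (n ⊖ 3))    ∎)

open import Data.Nat using (_+_; _*_; _≤_)
open import Data.Integer using (+_; _-_)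
open import Data.List using (length)
open PartialMatchings using (length-P; #partials; #partials≡partials; partials)
open ClosedForms using (two-crossings)

mainTheorem4 : (n : ℕ) → 1 ≤ n →
    2 * length (P n 2) ≡ (n + 3) * binom (2 * n) (+ n - + 3)
mainTheorem4 n _ = begin
  2 * length (P n 2)                   ≡⟨ cong (2 *_) (length-P n 2) ⟩
  2 * #partials (2 * n) 0 2            ≡⟨ cong (2 *_) (#partials≡partials (2 * n) 0 2) ⟩
  2 * partials (2 * n) 0 2             ≡⟨ two-crossings n ⟩
  (n + 3) * binom (2 * n) (+ n - + 3)  ∎
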